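{- For every integer $n \ge 1$, $\gamma_t(Q_n) = \gamma_{\rm pr}(Q_{n}) = \gamma_{\rm tr}(Q_{n})$.
   Context: $Q_n$ is the $n$-dimensional hypercube: vertices are binary strings of length $n$, two adjacent iff they differ in exactly one coordinate. For a graph $F$: a total dominating set is a set $S\subseteq V(F)$ such that every vertex of $F$ has a neighbor in $S$, and $\gamma_t(F)$ is its minimum size; a paired-dominating set is a set $S$ such that every vertex of $F$ is adjacent to a vertex of $S$ and the subgraph induced by $S$ contains a perfect matching, and $\gamma_{\rm pr}(F)$ is its minimum size; a total restrained dominating set is a total dominating set $S$ such that every vertex outside $S$ has a neighbor outside $S$, and $\gamma_{\rm tr}(F)$ is its minimum size. -}

module Defs where

open import Data.Nat using (ℕ; zero; suc; _≤_; _+_)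
open import Data.Bool using (Bool; _xor_; if_then_else_)
open import Data.Vec using (Vec; []; _∷_)
open import Data.List using (List; []; _∷_; length; concatMap)
open import Data.List.Membership.Propositional using (_∈_; _∉_)
open import Data.List.Relation.Unary.Unique.Propositional using (Unique)
open import Data.List.Relation.Unary.All using (All)
open import Data.List.Relation.Binary.Permutation.Propositional using (_↭_)
open import Data.Product using (Σ; ∃; ∃-syntax; _×_; _,_; proj₁; proj₂)
open import Relation.Binary.PropositionalEquality using (_≡_; _≢_)

Vertex : ℕ → Set
Vertex n = Vec Bool n

hamming : ∀ {n} → Vec Bool n → Vec Bool n → ℕ
hamming [] [] = 0
hamming (x ∷ xs) (y ∷ ys) = (if x xor y then 1 else 0) + hamming xs ys

Adj : ∀ {n} → Vertex n → Vertex n → Set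
Adj u v = hamming u v ≡ 1

-- A vertex set is a duplicate-free list of vertices; its size is its length.
VSet : ℕ → Set
VSet n = List (Vertex n)

IsTotalDominating : ∀ {n} → VSet n → Set
IsTotalDominating {n} S = (v : Vertex n) → ∃[ u ] (u ∈ S × Adj v u)

-- Induced subgraph Q_n[S] has a perfect matching: a list of adjacent pairs
-- whose vertices, listed, are exactly S (each vertex of S exactly once).
pairVerts : ∀ {n} → List (Vertex n × Vertex n) → List (Vertex n)
pairVerts [] = []
pairVerts ((a , b) ∷ ps) = a ∷ b ∷ pairVerts ps

HasPerfectMatching : ∀ {n} → VSet n → Set
HasPerfectMatching {n} S =
  ∃[ M ] (All (λ (e : Vertex n × Vertex n) → Adj (proj₁ e) (proj₂ e)) M
          × pairVerts M ↭ S)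

IsPairedDominating : ∀ {n} → VSet n → Set
IsPairedDominating S = IsTotalDominating S × HasPerfectMatching S

IsTotalRestrainedDominating : ∀ {n} → VSet n → Set
IsTotalRestrainedDominating {n} S =
  IsTotalDominating S × ((v : Vertex n) → v ∉ S → ∃[ u ] (u ∉ S × Adj v u))

IsMinSize : ∀ {n} → (VSet n → Set) → ℕ → Set
IsMinSize {n} P k =
  (∃[ S ] (Unique S × P S × length S ≡ k)) ×
  ((S : VSet n) → Unique S → P S → k ≤ length S)

γt : ℕ → ℕ → Set
γt n k = IsMinSize {n} IsTotalDominating k

γpr : ℕ → ℕ → Set
γpr n k = IsMinSize {n} IsPairedDominating k

γtr : ℕ → ℕ → Set
γtr n k = IsMinSize {n} IsTotalRestrainedDominating k

-- Write Q_{m+1} as Q_m × K₂. If D is a minimum dominating set of Q_m, the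
-- doubled set D × {0,1} totally dominates Q_{m+1}, is perfectly matched by
-- its rungs (0 ∷ d , 1 ∷ d), and leaves every vertex outside it adjacent to
-- its (also outside) partner across the rung; so all three parameters are
-- at most 2γ(Q_m). Conversely, adjacency flips the parity of a vertex, so
-- the vertices of parity not c are totally dominated by vertices of parity c;
-- deleting the first coordinate, the elements of parity c of a total
-- dominating set S therefore project onto a dominating set of Q_m. Hence
-- |S| ≥ 2γ(Q_m), and γ_t(Q_{m+1}) = γ_pr(Q_{m+1}) = γ_tr(Q_{m+1}) = 2γ(Q_m).
module Submission where

open import Defs
open import Data.Nat using (ℕ; _≥_; zero; suc; _≤_; _+_; z≤n; s≤s; pred)
open import Data.Nat.Properties using (≤-trans; +-suc; +-mono-≤; module ≤-Reasoning)
import Data.Nat.Properties as ℕ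
open import Data.Bool using (Bool; true; false; not; _xor_)
open import Data.Bool.Properties using (not-involutive; xor-assoc; xor-same; xor-identityʳ)
import Data.Bool.Properties as Bool
open import Data.Vec using ([]; _∷_; tail)
open import Data.Vec.Properties using (∷-injectiveʳ)
import Data.Vec.Properties as Vec
open import Data.List using (List; []; _∷_; length; map; _++_; filter)
open import Data.List.Properties using (length-++; length-map)
open import Data.List.Relation.Unary.Any using (here; there; any?)
open import Data.List.Relation.Unary.All using (all?; []; _∷_)
import Data.List.Relation.Unary.All as All
import Data.List.Relation.Unary.All.Properties as All
open import Data.List.Relation.Unary.Unique.Propositional using (Unique; []; _∷_)
import Data.List.Relation.Unary.Unique.Propositional.Properties as Unique
open import Data.List.Membership.Propositional using (_∈_; _∉_; find; lose)
open import Data.List.Membership.Propositional.Properties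
  using (∈-++⁺ˡ; ∈-++⁺ʳ; ∈-++⁻; ∈-∃++; ∈-map⁺; ∈-map⁻; ∈-filter⁺; ∈-filter⁻)
open import Data.List.Relation.Binary.Subset.Propositional using (_⊆_)
open import Data.List.Relation.Binary.Permutation.Propositional using (↭-refl)
open import Data.List.Extrema.Nat using (argmin; argmin-all; f[argmin]≤f[xs])
open import Data.Product using (∃-syntax; _×_; _,_; proj₁; proj₂)
open import Data.Sum using (_⊎_; inj₁; inj₂)
open import Data.Empty using (⊥-elim)
open import Relation.Binary.PropositionalEquality
  using (_≡_; _≢_; refl; sym; trans; cong; cong₂; module ≡-Reasoning)
open import Relation.Nullary using (Dec; does; ¬_)
open import Relation.Nullary.Decidable using (map′; _⊎-dec_)
open import Relation.Unary using (Decidable)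

private
  variable
    m : ℕ

Unique∧⊆⇒length≤ : {A : Set} {xs ys : List A} → Unique xs → xs ⊆ ys → length xs ≤ length ys
Unique∧⊆⇒length≤ {xs = []} _ _ = z≤n
Unique∧⊆⇒length≤ {xs = x ∷ xs} (x∉xs ∷ xs-unique) xs⊆ys with ∈-∃++ (xs⊆ys (here refl))
... | ys₁ , ys₂ , refl = begin
  suc (length xs)               ≤⟨ s≤s (Unique∧⊆⇒length≤ xs-unique xs⊆ys₁ys₂) ⟩
  suc (length (ys₁ ++ ys₂))     ≡⟨ cong suc (length-++ ys₁) ⟩
  suc (length ys₁ + length ys₂) ≡⟨ +-suc (length ys₁) (length ys₂) ⟨
  length ys₁ + length (x ∷ ys₂) ≡⟨ length-++ ys₁ ⟨
  length (ys₁ ++ x ∷ ys₂)       ∎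
  where
  open ≤-Reasoning
  xs⊆ys₁ys₂ : xs ⊆ ys₁ ++ ys₂
  xs⊆ys₁ys₂ y∈xs with ∈-++⁻ ys₁ (xs⊆ys (there y∈xs))
  ... | inj₁ y∈ys₁         = ∈-++⁺ˡ y∈ys₁
  ... | inj₂ (here refl)   = ⊥-elim (All.lookup x∉xs y∈xs refl)
  ... | inj₂ (there y∈ys₂) = ∈-++⁺ʳ ys₁ y∈ys₂

sublists : {A : Set} → List A → List (List A)
sublists []       = [] ∷ []
sublists (x ∷ xs) = map (x ∷_) (sublists xs) ++ sublists xs

filter∈sublists : {A : Set} {P : A → Set} (P? : Decidable P) (xs : List A) →
                  filter P? xs ∈ sublists xs
filter∈sublists P? []       = here refl
filter∈sublists P? (x ∷ xs) with does (P? x)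
... | true  = ∈-++⁺ˡ (∈-map⁺ (x ∷_) (filter∈sublists P? xs))
... | false = ∈-++⁺ʳ _ (filter∈sublists P? xs)

length-filter-false+true : {A : Set} (f : A → Bool) (xs : List A) →
  length (filter (λ x → f x Bool.≟ false) xs) + length (filter (λ x → f x Bool.≟ true) xs)
    ≡ length xs
length-filter-false+true f []       = refl
length-filter-false+true f (x ∷ xs) with f x
... | false = cong suc (length-filter-false+true f xs)
... | true  = trans (+-suc _ _) (cong suc (length-filter-false+true f xs))

vertices : (m : ℕ) → List (Vertex m)
vertices zero    = [] ∷ []
vertices (suc m) = map (false ∷_) (vertices m) ++ map (true ∷_) (vertices m)

∈-vertices : (v : Vertex m) → v ∈ vertices m
∈-vertices []          = here refl
∈-vertices (false ∷ v) = ∈-++⁺ˡ (∈-map⁺ (false ∷_) (∈-vertices v))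
∈-vertices (true ∷ v)  = ∈-++⁺ʳ _ (∈-map⁺ (true ∷_) (∈-vertices v))

Unique-vertices : (m : ℕ) → Unique (vertices m)
Unique-vertices zero    = [] ∷ []
Unique-vertices (suc m) = Unique.++⁺ (Unique.map⁺ ∷-injectiveʳ (Unique-vertices m))
                                     (Unique.map⁺ ∷-injectiveʳ (Unique-vertices m))
                                     heads-differ
  where
  heads-differ : ∀ {v} → ¬ (v ∈ map (false ∷_) (vertices m) × v ∈ map (true ∷_) (vertices m))
  heads-differ (p , q) with ∈-map⁻ (false ∷_) p | ∈-map⁻ (true ∷_) q
  ... | _ , _ , refl | _ , _ , ()

hamming-refl : (v : Vertex m) → hamming v v ≡ 0
hamming-refl []          = refl
hamming-refl (false ∷ v) = hamming-refl v
hamming-refl (true ∷ v)  = hamming-refl v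

hamming≡0⇒≡ : (v w : Vertex m) → hamming v w ≡ 0 → v ≡ w
hamming≡0⇒≡ []          []          _ = refl
hamming≡0⇒≡ (false ∷ v) (false ∷ w) h = cong (false ∷_) (hamming≡0⇒≡ v w h)
hamming≡0⇒≡ (true ∷ v)  (true ∷ w)  h = cong (true ∷_) (hamming≡0⇒≡ v w h)

Adj-∷-not : (b : Bool) (v : Vertex m) → Adj (b ∷ v) (not b ∷ v)
Adj-∷-not false v = cong suc (hamming-refl v)
Adj-∷-not true  v = cong suc (hamming-refl v)

Adj-∷ : (b : Bool) (v w : Vertex m) → Adj v w → Adj (b ∷ v) (b ∷ w)
Adj-∷ false v w a = a
Adj-∷ true  v w a = a

Adj-∷⁻ : (x y : Bool) (v w : Vertex m) → Adj (x ∷ v) (y ∷ w) → w ≡ v ⊎ Adj v w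
Adj-∷⁻ x y v w a with x xor y
... | true  = inj₁ (sym (hamming≡0⇒≡ v w (cong pred a)))
... | false = inj₂ a

parity : Vertex m → Bool
parity []      = false
parity (b ∷ v) = b xor parity v

parity-Adj : (v w : Vertex m) → Adj v w → parity w ≡ not (parity v)
parity-Adj [] [] ()
parity-Adj (false ∷ v) (false ∷ w) a = parity-Adj v w a
parity-Adj (true ∷ v)  (true ∷ w)  a = cong not (parity-Adj v w a)
parity-Adj (false ∷ v) (true ∷ w)  a rewrite hamming≡0⇒≡ v w (cong pred a) = refl
parity-Adj (true ∷ v)  (false ∷ w) a rewrite hamming≡0⇒≡ v w (cong pred a) = sym (not-involutive _)

parity-∷-xor : (c : Bool) (v : Vertex m) → parity ((c xor parity v) ∷ v) ≡ c
parity-∷-xor c v = begin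
  (c xor parity v) xor parity v ≡⟨ xor-assoc c (parity v) (parity v) ⟩
  c xor (parity v xor parity v) ≡⟨ cong (c xor_) (xor-same (parity v)) ⟩
  c xor false                   ≡⟨ xor-identityʳ c ⟩
  c                             ∎
  where open ≡-Reasoning

_≟ᵥ_ : (v w : Vertex m) → Dec (v ≡ w)
_≟ᵥ_ = Vec.≡-dec Bool._≟_

_∈?_ : (v : Vertex m) (D : VSet m) → Dec (v ∈ D)
v ∈? D = any? (v ≟ᵥ_) D

IsDominating : VSet m → Set
IsDominating {m} D = (v : Vertex m) → ∃[ u ] (u ∈ D × (u ≡ v ⊎ Adj v u))

IsDominating? : (D : VSet m) → Dec (IsDominating D)
IsDominating? {m} D = map′
  (λ all-close v → find (All.lookup all-close (∈-vertices v)))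
  (λ dom → All.tabulate λ {v} _ → let (_ , u∈D , close) = dom v in lose u∈D close)
  (all? (λ v → any? (λ u → (u ≟ᵥ v) ⊎-dec (hamming v u ℕ.≟ 1)) D) (vertices m))

IsDominating-mono : {D D′ : VSet m} → D ⊆ D′ → IsDominating D → IsDominating D′
IsDominating-mono D⊆D′ dom v = let (u , u∈D , close) = dom v in u , D⊆D′ u∈D , close

vertices-dominating : (m : ℕ) → IsDominating (vertices m)
vertices-dominating m v = v , ∈-vertices v , inj₁ refl

trim : VSet m → VSet m
trim {m} D = filter (_∈? D) (vertices m)

Unique-trim : (D : VSet m) → Unique (trim D)
Unique-trim {m} D = Unique.filter⁺ (_∈? D) (Unique-vertices m)

trim-⊆ : (D : VSet m) → trim D ⊆ D
trim-⊆ {m} D v∈ = proj₂ (∈-filter⁻ (_∈? D) {xs = vertices m} v∈)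

⊆-trim : (D : VSet m) → D ⊆ trim D
⊆-trim D v∈ = ∈-filter⁺ (_∈? D) (∈-vertices _) v∈

length-trim : (D : VSet m) → length (trim D) ≤ length D
length-trim D = Unique∧⊆⇒length≤ (Unique-trim D) (trim-⊆ D)

IsMinSize-IsDominating-≤ : {k : ℕ} {D : VSet m} → IsMinSize IsDominating k →
                           IsDominating D → k ≤ length D
IsMinSize-IsDominating-≤ {D = D} (_ , minimal) dom =
  ≤-trans (minimal (trim D) (Unique-trim D) (IsDominating-mono (⊆-trim D) dom)) (length-trim D)

-- D₀ minimises length over the dominating sublists of vertices m; trim D is
-- such a sublist for any dominating D, and no longer than D.
domination-number : (m : ℕ) → ∃[ k ] IsMinSize {m} IsDominating k
domination-number m = length (trim D₀) ,
  (trim D₀ , Unique-trim D₀ , IsDominating-mono (⊆-trim D₀) D₀-dominating , refl) ,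
  λ D _ dom → ≤-trans (length-trim D₀) (≤-trans (D₀-minimal D dom) (length-trim D))
  where
  dominatingSets : List (VSet m)
  dominatingSets = filter IsDominating? (sublists (vertices m))

  D₀ : VSet m
  D₀ = argmin length (vertices m) dominatingSets

  D₀-dominating : IsDominating D₀
  D₀-dominating = argmin-all length (vertices-dominating m)
    (All.tabulate λ D∈ → proj₂ (∈-filter⁻ IsDominating? {xs = sublists (vertices m)} D∈))

  D₀-minimal : (D : VSet m) → IsDominating D → length D₀ ≤ length (trim D)
  D₀-minimal D dom = All.lookup (f[argmin]≤f[xs] {f = length} (vertices m) dominatingSets)
    (∈-filter⁺ IsDominating? (filter∈sublists (_∈? D) (vertices m))
                             (IsDominating-mono (⊆-trim D) dom))

rungs : VSet m → List (Vertex (suc m) × Vertex (suc m))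
rungs = map λ d → false ∷ d , true ∷ d

doubled : VSet m → VSet (suc m)
doubled D = pairVerts (rungs D)

∈-doubled⁺ : (b : Bool) {d : Vertex m} {D : VSet m} → d ∈ D → (b ∷ d) ∈ doubled D
∈-doubled⁺ false (here refl) = here refl
∈-doubled⁺ true  (here refl) = there (here refl)
∈-doubled⁺ b     (there d∈D) = there (there (∈-doubled⁺ b d∈D))

∈-doubled⁻ : {b : Bool} {d : Vertex m} (D : VSet m) → (b ∷ d) ∈ doubled D → d ∈ D
∈-doubled⁻ (_ ∷ _) (here refl)         = here refl
∈-doubled⁻ (_ ∷ _) (there (here refl)) = here refl
∈-doubled⁻ (_ ∷ D) (there (there p))   = there (∈-doubled⁻ D p)

length-doubled : (D : VSet m) → length (doubled D) ≡ length D + length D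
length-doubled []      = refl
length-doubled (d ∷ D) = cong suc (trans (cong suc (length-doubled D)) (sym (+-suc _ _)))

Unique-doubled : {D : VSet m} → Unique D → Unique (doubled D)
Unique-doubled {D = []}    _              = []
Unique-doubled {D = d ∷ D} (d∉D ∷ D-unique) =
  ((λ ()) ∷ ∉-doubled false) ∷ ∉-doubled true ∷ Unique-doubled D-unique
  where
  ∉-doubled : (b : Bool) → All.All ((b ∷ d) ≢_) (doubled D)
  ∉-doubled b = All.tabulate λ { p refl → All.lookup d∉D (∈-doubled⁻ D p) refl }

doubled-IsTotalDominating : {D : VSet m} → IsDominating D → IsTotalDominating (doubled D)
doubled-IsTotalDominating dom (b ∷ w) with dom w
... | u , u∈D , inj₁ refl = not b ∷ u , ∈-doubled⁺ (not b) u∈D , Adj-∷-not b u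
... | u , u∈D , inj₂ adj  = b ∷ u , ∈-doubled⁺ b u∈D , Adj-∷ b w u adj

doubled-HasPerfectMatching : (D : VSet m) → HasPerfectMatching (doubled D)
doubled-HasPerfectMatching D = rungs D , All.map⁺ (All.universal (Adj-∷-not false) D) , ↭-refl

doubled-complement-total : (D : VSet m) (v : Vertex (suc m)) → v ∉ doubled D →
                           ∃[ u ] (u ∉ doubled D × Adj v u)
doubled-complement-total D (b ∷ w) v∉ =
  not b ∷ w , (λ p → v∉ (∈-doubled⁺ b (∈-doubled⁻ D p))) , Adj-∷-not b w

ofParity : Bool → VSet m → VSet m
ofParity c = filter λ x → parity x Bool.≟ c

layer : Bool → VSet (suc m) → VSet m
layer c S = map tail (ofParity c S)

length-layers : (S : VSet (suc m)) → length (layer false S) + length (layer true S) ≡ length S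
length-layers S = trans
  (cong₂ _+_ (length-map tail (ofParity false S)) (length-map tail (ofParity true S)))
  (length-filter-false+true parity S)

layer-IsDominating : {S : VSet (suc m)} → IsTotalDominating S →
                     (c : Bool) → IsDominating (layer c S)
layer-IsDominating {m} {S} tdom c v = project (tdom (x ∷ v))
  where
  x : Bool
  x = not c xor parity v

  neighbour-parity : (y : Vertex (suc m)) → Adj (x ∷ v) y → parity y ≡ c
  neighbour-parity y adj = begin
    parity y             ≡⟨ parity-Adj (x ∷ v) y adj ⟩
    not (parity (x ∷ v)) ≡⟨ cong not (parity-∷-xor (not c) v) ⟩
    not (not c)          ≡⟨ not-involutive c ⟩
    c                    ∎
    where open ≡-Reasoning

  project : ∃[ y ] (y ∈ S × Adj (x ∷ v) y) → ∃[ u ] (u ∈ layer c S × (u ≡ v ⊎ Adj v u))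
  project (b ∷ w , y∈S , adj) =
    w , ∈-map⁺ tail (∈-filter⁺ (λ y → parity y Bool.≟ c) y∈S (neighbour-parity (b ∷ w) adj)) ,
    Adj-∷⁻ x b v w adj

IsTotalDominating⇒γ+γ≤ : {γ : ℕ} {S : VSet (suc m)} → IsMinSize IsDominating γ →
                          IsTotalDominating S → γ + γ ≤ length S
IsTotalDominating⇒γ+γ≤ {γ = γ} {S = S} γ-min tdom = begin
  γ + γ                                           ≤⟨ +-mono-≤ (bound false) (bound true) ⟩
  length (layer false S) + length (layer true S)  ≡⟨ length-layers S ⟩
  length S                                        ∎
  where
  open ≤-Reasoning
  bound : (c : Bool) → γ ≤ length (layer c S)
  bound c = IsMinSize-IsDominating-≤ γ-min (layer-IsDominating tdom c)

IsMinSize-doubled : {γ : ℕ} {P : VSet (suc m) → Set} → IsMinSize IsDominating γ →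
                    ((D : VSet m) → IsDominating D → P (doubled D)) →
                    ((S : VSet (suc m)) → P S → IsTotalDominating S) →
                    IsMinSize P (γ + γ)
IsMinSize-doubled γ-min@((D , D-unique , dom , |D|≡γ) , _) P-doubled P⇒total =
  (doubled D , Unique-doubled D-unique , P-doubled D dom ,
   trans (length-doubled D) (cong₂ _+_ |D|≡γ |D|≡γ)) ,
  λ S _ pS → IsTotalDominating⇒γ+γ≤ γ-min (P⇒total S pS)

corollary4 : (n : ℕ) → n ≥ 1 → ∃[ k ] (γt n k × γpr n k × γtr n k)
corollary4 (suc m) _ with domination-number m
... | γ , γ-min =
  γ + γ ,
  IsMinSize-doubled γ-min (λ _ → doubled-IsTotalDominating) (λ _ tdom → tdom) ,
  IsMinSize-doubled γ-min
    (λ D dom → doubled-IsTotalDominating dom , doubled-HasPerfectMatching D) (λ _ → proj₁) ,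
  IsMinSize-doubled γ-min
    (λ D dom → doubled-IsTotalDominating dom , doubled-complement-total D) (λ _ → proj₁)
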